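{- Let $T$ be a triangulation of a convex $(n+2)$-gon $P$ and $\varepsilon$ a signing of its faces. Suppose that $\Sigma(T_\varepsilon)$ contains two signed triangulations $U_{\varepsilon'}$ and $U_{\varepsilon''}$ with the same underlying triangulation $U$. Then $\varepsilon'=\varepsilon''$.
   Context: A triangulation of a convex $(n+2)$-gon $P$ is a set of $n-1$ noncrossing diagonals cutting $P$ into $n$ triangular faces. A signed triangulation $T_\varepsilon$ is a triangulation $T$ together with a map $\varepsilon$ from the set of faces of $T$ to $\{ -,+\}$. A signed flip transforms $T_\varepsilon$ into $T'_{\varepsilon'}$ as follows: $d$ is a diagonal of $T$ whose two adjacent faces have the same sign $s$; $T'$ is obtained by replacing $d$ by the other diagonal $d'$ of the quadrilateral formed by these two faces; the two faces of $T'$ adjacent to $d'$ receive the sign $-s$, and every other face (common to $T$ and $T'$) keeps its sign. $\Sigma(T_\varepsilon)$ is the set of all signed triangulations obtained from $T_\varepsilon$ by applying finite sequences of signed flips. -}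

module Defs where

open import Data.Nat using (ℕ; zero; suc; _+_; _∸_)
open import Data.Fin using (Fin; toℕ; _<_)
open import Data.Product using (_×_; _,_; ∃; Σ)
open import Data.Sum using (_⊎_)
open import Data.List using (List; length)
open import Data.List.Membership.Propositional using (_∈_)
open import Data.List.Relation.Unary.All using (All)
open import Data.List.Relation.Unary.AllPairs using (AllPairs)
open import Data.List.Relation.Unary.Unique.Propositional using (Unique)
open import Relation.Binary.PropositionalEquality using (_≡_; _≢_)
open import Relation.Nullary using (¬_)
open import Relation.Binary.Construct.Closure.ReflexiveTransitive using (Star)
open import Function.Bundles using (_⇔_)

-- Vertices of the convex (n+2)-gon P are 0,1,…,n+1 in cyclic order.
Vertex : ℕ → Set
Vertex n = Fin (n + 2)

-- A segment between two vertices, always written (i , j) with i < j.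
Seg : ℕ → Set
Seg n = Vertex n × Vertex n

IsBoundary : (n : ℕ) → Seg n → Set
IsBoundary n (i , j) = (suc (toℕ i) ≡ toℕ j) ⊎ ((toℕ i ≡ 0) × (toℕ j ≡ suc n))

IsDiagonal : (n : ℕ) → Seg n → Set
IsDiagonal n (i , j) = (i < j) × ¬ IsBoundary n (i , j)

Cross : (n : ℕ) → Seg n → Seg n → Set
Cross n (i , j) (k , l) = ((i < k) × (k < j) × (j < l)) ⊎ ((k < i) × (i < l) × (l < j))

NonCrossing : (n : ℕ) → Seg n → Seg n → Set
NonCrossing n d e = ¬ Cross n d e

record Triangulation (n : ℕ) : Set where
  field
    diags       : List (Seg n)
    allDiagonal : All (IsDiagonal n) diags
    unique      : Unique diags
    noncrossing : AllPairs (NonCrossing n) diags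
    size        : length diags ≡ n ∸ 1
open Triangulation public

SameTriangulation : {n : ℕ} → Triangulation n → Triangulation n → Set
SameTriangulation T U = ∀ d → (d ∈ diags T) ⇔ (d ∈ diags U)

IsSide : {n : ℕ} → Triangulation n → Seg n → Set
IsSide {n} T d = IsBoundary n d ⊎ (d ∈ diags T)

-- Triangles are written (a , b , c) with a < b < c.
Tri : ℕ → Set
Tri n = Vertex n × Vertex n × Vertex n

IsFace : {n : ℕ} → Triangulation n → Tri n → Set
IsFace T (a , b , c) = (a < b) × (b < c) × IsSide T (a , b) × IsSide T (b , c) × IsSide T (a , c)

data Sign : Set where
  minus plus : Sign

neg : Sign → Sign
neg minus = plus
neg plus  = minus

-- A signed triangulation: a triangulation with a sign on each face
-- (the values of ε on non-faces are irrelevant and never inspected).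
record SignedTriangulation (n : ℕ) : Set where
  constructor _,ε_
  field
    tri : Triangulation n
    sgn : Tri n → Sign
open SignedTriangulation public

-- Flip of the diagonal d of the quadrilateral a<b<c<e into the other diagonal d'
-- of that quadrilateral, with faces f₁ f₂ (adjacent to d in T) and f₁' f₂' (adjacent to d' in T').
record FlipData {n : ℕ} (S S' : SignedTriangulation n) (d d' : Seg n) (f₁ f₂ f₁' f₂' : Tri n) : Set where
  field
    d∈T       : d ∈ diags (tri S)
    face₁     : IsFace (tri S) f₁
    face₂     : IsFace (tri S) f₂
    sameSign  : sgn S f₁ ≡ sgn S f₂
    newDiags  : ∀ x → (x ∈ diags (tri S')) ⇔ (((x ∈ diags (tri S)) × (x ≢ d)) ⊎ (x ≡ d'))
    newSign₁  : sgn S' f₁' ≡ neg (sgn S f₁)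
    newSign₂  : sgn S' f₂' ≡ neg (sgn S f₁)
    keepSigns : ∀ f → IsFace (tri S') f → f ≢ f₁' → f ≢ f₂' → sgn S' f ≡ sgn S f

SignedFlip : {n : ℕ} → SignedTriangulation n → SignedTriangulation n → Set
SignedFlip {n} S S' =
  Σ (Vertex n) λ a → Σ (Vertex n) λ b → Σ (Vertex n) λ c → Σ (Vertex n) λ e →
    (a < b) × (b < c) × (c < e) ×
    (  FlipData S S' (a , c) (b , e) (a , b , c) (a , c , e) (a , b , e) (b , c , e)
     ⊎ FlipData S S' (b , e) (a , c) (a , b , e) (b , c , e) (a , b , c) (a , c , e))

InSigma : {n : ℕ} → SignedTriangulation n → SignedTriangulation n → Set
InSigma S S' = Star SignedFlip S S'

{-# OPTIONS --safe #-}

-- Let the signed degree of a vertex v in a signed triangulation be the number of positive faces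
-- at v minus the number of negative faces at v.  A signed flip of sign s in the quadrilateral
-- a < b < c < e trades two faces of sign s for two faces of sign −s; as every vertex of a
-- quadrilateral is a corner of three of its four triangles, the signed degree of v changes by
-- −3s if v ∈ {a, b, c, e} and not at all otherwise.  So signed degrees modulo 3 are constant
-- on Σ(T_ε).
--
-- Modulo 3 they also determine the signs on a fixed triangulation U.  If (a, b, c) is a face
-- with a < b < c, every other face at b lies in the arc from a to c and so has smaller span c − a.
-- By induction on the span these faces carry the same sign under ε' and ε'', so the two signed
-- degrees of b differ by the difference of the values ±1 of ε' and ε'' at (a, b, c).  That
-- difference is 0 or ±2, and divisible by 3 only if it is 0.

module Submission where

open import Defs
open import Data.Nat as ℕ using (ℕ; _∸_)
import Data.Nat.Properties as ℕ
import Data.Nat.Divisibility as ℕ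
open import Data.Nat.Induction using (<-wellFounded)
open import Data.Integer using (ℤ; +_; 0ℤ; 1ℤ; -1ℤ; _+_; _-_; _*_; -_)
open import Data.Integer.Properties
  using (+-*-semiring; +-inverseʳ; +-comm; +-identityˡ; +-identityʳ; *-identityˡ; *-zeroˡ; neg-distribʳ-*)
open import Data.Integer.Divisibility.Signed using (_∣_; divides; ∣m∣n⇒∣m+n; ∣m⇒∣-m; ∣m⇒∣m*n; ∣⇒∣ᵤ)
open import Data.Integer.Tactic.RingSolver using (solve-∀)
open import Algebra.Properties.Semiring.Sum +-*-semiring using (sum; sum-syntax; sum-cong-≗)
open import Data.Fin using (Fin; zero; suc; toℕ; _<_; _≤_; _<?_)
open import Data.Fin.Properties using (_≟_; suc-injective; <-cmp; <⇒≢; <-trans; <-irrefl; toℕ<n; ≤∧≢⇒<)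
open import Data.Bool using (if_then_else_)
open import Data.Product using (_×_; _,_; proj₁; proj₂)
open import Data.Product.Properties using (≡-dec; ,-injectiveˡ; ,-injectiveʳ)
open import Data.Sum using (_⊎_; inj₁; inj₂; [_,_]′; swap)
open import Data.Empty using (⊥-elim)
open import Data.List using (List; []; _∷_; map; foldr)
open import Data.List.Properties using (map-cong-local)
open import Data.List.Membership.Propositional using (_∈_; _∉_)
open import Data.List.Membership.Propositional.Properties using (∈-AllPairs₂)
open import Data.List.Relation.Unary.Any using (here; there; any?)
import Data.List.Relation.Unary.All as All
open import Data.List.Relation.Unary.All using ([]; _∷_)
open import Data.List.Relation.Unary.AllPairs using ([]; _∷_)
open import Data.List.Relation.Unary.Unique.Propositional using (Unique)
open import Function using (id; _∘_; _$_; _on_)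
open import Function.Bundles using (_⇔_; Equivalence)
open import Induction.WellFounded using (Acc; acc)
import Relation.Binary.Construct.On as On
open import Relation.Binary.Construct.Closure.ReflexiveTransitive as Star using (_◅_)
open import Relation.Binary.Definitions using (DecidableEquality; tri<; tri≈; tri>)
open import Relation.Binary.PropositionalEquality
open import Relation.Nullary using (¬_; Dec; yes; no; does)
open import Relation.Nullary.Decidable using (_×-dec_; _⊎-dec_; dec-true; dec-false)
open ≡-Reasoning

-- Sums over triples

sum-agree-off : ∀ {k} (j : Fin k) {g h : Fin k → ℤ} → (∀ i → i ≢ j → g i ≡ h i) →
                sum g - sum h ≡ g j - h j
sum-agree-off zero {g} {h} agree = begin
  (g zero + sum (g ∘ suc)) - (h zero + sum (h ∘ suc))
    ≡⟨ cong (λ x → (g zero + x) - (h zero + sum (h ∘ suc))) (sum-cong-≗ (λ i → agree (suc i) λ ())) ⟩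
  (g zero + sum (h ∘ suc)) - (h zero + sum (h ∘ suc))
    ≡⟨ [x+z]-[y+z] (g zero) (h zero) (sum (h ∘ suc)) ⟩
  g zero - h zero ∎
  where
  [x+z]-[y+z] : ∀ x y z → (x + z) - (y + z) ≡ x - y
  [x+z]-[y+z] = solve-∀
sum-agree-off (suc j) {g} {h} agree = begin
  (g zero + sum (g ∘ suc)) - (h zero + sum (h ∘ suc))
    ≡⟨ cong (λ x → (x + sum (g ∘ suc)) - (h zero + sum (h ∘ suc))) (agree zero λ ()) ⟩
  (h zero + sum (g ∘ suc)) - (h zero + sum (h ∘ suc))
    ≡⟨ [z+x]-[z+y] (h zero) (sum (g ∘ suc)) (sum (h ∘ suc)) ⟩
  sum (g ∘ suc) - sum (h ∘ suc)
    ≡⟨ sum-agree-off j (λ i i≢j → agree (suc i) (i≢j ∘ suc-injective)) ⟩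
  g (suc j) - h (suc j) ∎
  where
  [z+x]-[z+y] : ∀ z x y → (z + x) - (z + y) ≡ x - y
  [z+x]-[z+y] = solve-∀

module _ {k l m : ℕ} where

  ∑³ : (Fin k × Fin l × Fin m → ℤ) → ℤ
  ∑³ g = ∑[ a < k ] ∑[ b < l ] ∑[ c < m ] g (a , b , c)

  ∑³-cong : ∀ {g h} → (∀ t → g t ≡ h t) → ∑³ g ≡ ∑³ h
  ∑³-cong g≗h = sum-cong-≗ λ a → sum-cong-≗ λ b → sum-cong-≗ λ c → g≗h (a , b , c)

  ∑³-agree-off : ∀ p {g h} → (∀ t → t ≢ p → g t ≡ h t) → ∑³ g - ∑³ h ≡ g p - h p
  ∑³-agree-off (a₀ , b₀ , c₀) {g} {h} agree = begin
    ∑³ g - ∑³ h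
      ≡⟨ sum-agree-off a₀ (λ a a≢a₀ → sum-cong-≗ {l} λ b → sum-cong-≗ {m} λ c →
           agree _ (a≢a₀ ∘ cong proj₁)) ⟩
    ∑[ b < l ] ∑[ c < m ] g (a₀ , b , c) - ∑[ b < l ] ∑[ c < m ] h (a₀ , b , c)
      ≡⟨ sum-agree-off b₀ (λ b b≢b₀ → sum-cong-≗ {m} λ c →
           agree _ (b≢b₀ ∘ cong (proj₁ ∘ proj₂))) ⟩
    ∑[ c < m ] g (a₀ , b₀ , c) - ∑[ c < m ] h (a₀ , b₀ , c)
      ≡⟨ sum-agree-off c₀ (λ c c≢c₀ → agree _ (c≢c₀ ∘ cong (proj₂ ∘ proj₂))) ⟩
    g (a₀ , b₀ , c₀) - h (a₀ , b₀ , c₀) ∎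

  ∑³-agree-outside : ∀ ps {g h} → Unique ps → (∀ t → t ∉ ps → g t ≡ h t) →
                     ∑³ g - ∑³ h ≡ foldr _+_ 0ℤ (map (λ p → g p - h p) ps)
  ∑³-agree-outside [] {g} {h} _ agree = begin
    ∑³ g - ∑³ h ≡⟨ cong (_- ∑³ h) (∑³-cong λ t → agree t λ ()) ⟩
    ∑³ h - ∑³ h ≡⟨ +-inverseʳ (∑³ h) ⟩
    0ℤ          ∎
  ∑³-agree-outside (p ∷ ps) {g} {h} (p∉ps ∷ ps-unique) agree = begin
    ∑³ g - ∑³ h
      ≡⟨ split (∑³ g) (∑³ g′) (∑³ h) ⟩
    (∑³ g - ∑³ g′) + (∑³ g′ - ∑³ h)
      ≡⟨ cong₂ _+_ (∑³-agree-off p (λ t t≢p → sym (g′≡g-off-p t t≢p)))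
                   (∑³-agree-outside ps ps-unique g′≡h-outside) ⟩
    (g p - g′ p) + foldr _+_ 0ℤ (map (λ q → g′ q - h q) ps)
      ≡⟨ cong₂ (λ x xs → (g p - x) + foldr _+_ 0ℤ xs) g′≡h-at-p
           (map-cong-local (All.map (λ p≢q → cong (_- h _) (g′≡g-off-p _ (p≢q ∘ sym))) p∉ps)) ⟩
    (g p - h p) + foldr _+_ 0ℤ (map (λ q → g q - h q) ps) ∎
    where
    _≟³_ : DecidableEquality (Fin k × Fin l × Fin m)
    _≟³_ = ≡-dec _≟_ (≡-dec _≟_ _≟_)
    split : ∀ x y z → x - z ≡ (x - y) + (y - z)
    split = solve-∀
    g′ : Fin k × Fin l × Fin m → ℤ
    g′ t with t ≟³ p
    ... | yes _ = h p
    ... | no  _ = g t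
    g′≡h-at-p : g′ p ≡ h p
    g′≡h-at-p with p ≟³ p
    ... | yes _ = refl
    ... | no p≢p = ⊥-elim (p≢p refl)
    g′≡g-off-p : ∀ t → t ≢ p → g′ t ≡ g t
    g′≡g-off-p t t≢p with t ≟³ p
    ... | yes t≡p = ⊥-elim (t≢p t≡p)
    ... | no  _ = refl
    g′≡h-outside : ∀ t → t ∉ ps → g′ t ≡ h t
    g′≡h-outside t t∉ps with t ≟³ p
    ... | yes refl = refl
    ... | no t≢p = agree t λ { (here t≡p) → t≢p t≡p ; (there t∈ps) → t∉ps t∈ps }

-- Congruences and signs

infix 4 _≡_mod_
record _≡_mod_ (x y m : ℤ) : Set where
  constructor congruent
  field m∣y-x : m ∣ y - x

≡-mod-refl : ∀ {m} x → x ≡ x mod m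
≡-mod-refl {m} x = congruent (divides 0ℤ (trans (+-inverseʳ x) (sym (*-zeroˡ m))))

≡-mod-sym : ∀ {m x y} → x ≡ y mod m → y ≡ x mod m
≡-mod-sym {x = x} {y} (congruent m∣y-x) = congruent (subst (_ ∣_) (-[y-x]≡x-y y x) (∣m⇒∣-m m∣y-x))
  where
  -[y-x]≡x-y : ∀ y x → - (y - x) ≡ x - y
  -[y-x]≡x-y = solve-∀

≡-mod-trans : ∀ {m x y z} → x ≡ y mod m → y ≡ z mod m → x ≡ z mod m
≡-mod-trans {x = x} {y} {z} (congruent m∣y-x) (congruent m∣z-y) =
  congruent (subst (_ ∣_) (telescope x y z) (∣m∣n⇒∣m+n m∣z-y m∣y-x))
  where
  telescope : ∀ x y z → (z - y) + (y - x) ≡ z - x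
  telescope = solve-∀

≡-mod-difference : ∀ {m x y x' y'} → y - x ≡ y' - x' → x ≡ y mod m → x' ≡ y' mod m
≡-mod-difference eq (congruent m∣y-x) = congruent (subst (_ ∣_) eq m∣y-x)

σ : Sign → ℤ
σ plus  = 1ℤ
σ minus = -1ℤ

σ-neg : ∀ s → σ (neg s) ≡ - σ s
σ-neg plus  = refl
σ-neg minus = refl

σ-injective-mod-3 : ∀ {s s'} → σ s ≡ σ s' mod + 3 → s ≡ s'
σ-injective-mod-3 {plus}  {plus}  _ = refl
σ-injective-mod-3 {minus} {minus} _ = refl
σ-injective-mod-3 {plus}  {minus} (congruent 3∣-2) = ⊥-elim (ℕ.>⇒∤ ℕ.≤-refl (∣⇒∣ᵤ 3∣-2))
σ-injective-mod-3 {minus} {plus}  (congruent 3∣2)  = ⊥-elim (ℕ.>⇒∤ ℕ.≤-refl (∣⇒∣ᵤ 3∣2))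

-- Faces of a triangulation

module _ {n : ℕ} where

  Cross-sym : ∀ {d e} → Cross n d e → Cross n e d
  Cross-sym (inj₁ i<k<j<l) = inj₂ i<k<j<l
  Cross-sym (inj₂ k<i<l<j) = inj₁ k<i<l<j

  Cross-irrefl : ∀ {d} → ¬ Cross n d d
  Cross-irrefl (inj₁ (i<i , _)) = <-irrefl refl i<i
  Cross-irrefl (inj₂ (i<i , _)) = <-irrefl refl i<i

  -- A boundary edge has no vertex strictly inside it, or none strictly outside it.
  crossing⇒¬boundary : ∀ {d e} → Cross n d e → ¬ IsBoundary n d
  crossing⇒¬boundary (inj₁ (i<k , k<j , _)) (inj₁ 1+i≡j) = ℕ.<-irrefl 1+i≡j (ℕ.≤-<-trans i<k k<j)
  crossing⇒¬boundary {e = _ , l} (inj₁ (_ , _ , j<l)) (inj₂ (_ , j≡1+n)) =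
    ℕ.<⇒≱ (toℕ<n l)
      (subst (ℕ._≤ toℕ l) (ℕ.+-comm 2 n) (subst (λ j → ℕ.suc j ℕ.≤ toℕ l) j≡1+n j<l))
  crossing⇒¬boundary (inj₂ (_ , i<l , l<j)) (inj₁ 1+i≡j) = ℕ.<-irrefl 1+i≡j (ℕ.≤-<-trans i<l l<j)
  crossing⇒¬boundary {e = k , _} (inj₂ (k<i , _)) (inj₂ (i≡0 , _)) =
    ℕ.n≮0 (subst (toℕ k ℕ.<_) i≡0 k<i)

  sides-noncrossing : (T : Triangulation n) {d e : Seg n} → IsSide T d → IsSide T e → ¬ Cross n d e
  sides-noncrossing T (inj₁ d-boundary) _ d×e = crossing⇒¬boundary d×e d-boundary
  sides-noncrossing T _ (inj₁ e-boundary) d×e = crossing⇒¬boundary (Cross-sym d×e) e-boundary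
  sides-noncrossing T (inj₂ d∈T) (inj₂ e∈T) d×e with ∈-AllPairs₂ (noncrossing T) d∈T e∈T
  ... | inj₁ refl = Cross-irrefl d×e
  ... | inj₂ (inj₁ d∦e) = d∦e d×e
  ... | inj₂ (inj₂ e∦d) = e∦d (Cross-sym d×e)

  data HasSide : Tri n → Seg n → Set where
    side₁₂ : ∀ {x y z} → HasSide (x , y , z) (x , y)
    side₂₃ : ∀ {x y z} → HasSide (x , y , z) (y , z)
    side₁₃ : ∀ {x y z} → HasSide (x , y , z) (x , z)

  face-side : (T : Triangulation n) {t : Tri n} {s : Seg n} → IsFace T t → HasSide t s → IsSide T s
  face-side T (_ , _ , xy , _  , _ ) side₁₂ = xy
  face-side T (_ , _ , _  , yz , _ ) side₂₃ = yz
  face-side T (_ , _ , _  , _  , xz) side₁₃ = xz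

  face-from-sides : (T T' : Triangulation n) {t : Tri n} → IsFace T t →
                    (∀ {s} → HasSide t s → IsSide T s → IsSide T' s) → IsFace T' t
  face-from-sides T T' (x<y , y<z , xy , yz , xz) keep =
    x<y , y<z , keep side₁₂ xy , keep side₂₃ yz , keep side₁₃ xz

  -- A triangle on the side (p , q) has its third vertex inside the arc from p to q, as in
  -- (p , x , q), or outside it; the two outer shapes lie on the same side of (p , q).
  data Outer (p q : Vertex n) : Tri n → Set where
    left  : ∀ {y} → y < p → Outer p q (y , p , q)
    right : ∀ {y} → q < y → Outer p q (p , q , y)

  module _ (T : Triangulation n) where

    inner-apex-unique : ∀ {p q x y} → IsFace T (p , x , q) → IsFace T (p , y , q) → x ≡ y
    inner-apex-unique {x = x} {y} Fx@(p<x , _) Fy@(p<y , _) with <-cmp x y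
    ... | tri< x<y _ _ = ⊥-elim (sides-noncrossing T (face-side T Fy side₁₂) (face-side T Fx side₂₃)
                                   (inj₁ (p<x , x<y , proj₁ (proj₂ Fy))))
    ... | tri≈ _ x≡y _ = x≡y
    ... | tri> _ _ y<x = ⊥-elim (sides-noncrossing T (face-side T Fx side₁₂) (face-side T Fy side₂₃)
                                   (inj₁ (p<y , y<x , proj₁ (proj₂ Fx))))

    outer-face-unique : ∀ {p q o o'} → IsFace T o → IsFace T o' → Outer p q o → Outer p q o' → o ≡ o'
    outer-face-unique Fo Fo' (left {y} y<p) (left {y'} y'<p) with <-cmp y y'
    ... | tri< y<y' _ _ = ⊥-elim (sides-noncrossing T (face-side T Fo side₁₂) (face-side T Fo' side₁₃)
                                    (inj₁ (y<y' , y'<p , proj₁ (proj₂ Fo'))))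
    ... | tri≈ _ refl _ = refl
    ... | tri> _ _ y'<y = ⊥-elim (sides-noncrossing T (face-side T Fo' side₁₂) (face-side T Fo side₁₃)
                                    (inj₁ (y'<y , y<p , proj₁ (proj₂ Fo))))
    outer-face-unique Fo Fo' (right {y} q<y) (right {y'} q<y') with <-cmp y y'
    ... | tri< y<y' _ _ = ⊥-elim (sides-noncrossing T (face-side T Fo side₁₃) (face-side T Fo' side₂₃)
                                    (inj₁ (proj₁ Fo , q<y , y<y')))
    ... | tri≈ _ refl _ = refl
    ... | tri> _ _ y'<y = ⊥-elim (sides-noncrossing T (face-side T Fo' side₁₃) (face-side T Fo side₂₃)
                                    (inj₁ (proj₁ Fo , q<y' , y'<y)))
    outer-face-unique Fo Fo' (left y<p) (right q<y') = ⊥-elim (sides-noncrossing T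
      (face-side T Fo side₁₃) (face-side T Fo' side₁₃) (inj₁ (y<p , proj₁ Fo' , q<y')))
    outer-face-unique Fo Fo' (right q<y) (left y'<p) = ⊥-elim (sides-noncrossing T
      (face-side T Fo' side₁₃) (face-side T Fo side₁₃) (inj₁ (y'<p , proj₁ Fo , q<y)))

    faces-on-side : ∀ {p m q o t} → IsFace T (p , m , q) → IsFace T o → Outer p q o →
                    IsFace T t → HasSide t (p , q) → t ≡ (p , m , q) ⊎ t ≡ o
    faces-on-side Fi Fo o-outer Ft side₁₃ = inj₁ (cong (λ x → _ , x , _) (inner-apex-unique Ft Fi))
    faces-on-side Fi Fo o-outer Ft side₁₂ = inj₂ (outer-face-unique Ft Fo (right (proj₁ (proj₂ Ft))) o-outer)
    faces-on-side Fi Fo o-outer Ft side₂₃ = inj₂ (outer-face-unique Ft Fo (left (proj₁ Ft)) o-outer)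

  IsCorner : Vertex n → Tri n → Set
  IsCorner v (x , y , z) = v ≡ x ⊎ v ≡ y ⊎ v ≡ z

  corner-side-up : ∀ {v p q r} → IsCorner v (p , q , r) → p < v → HasSide (p , q , r) (p , v)
  corner-side-up (inj₁ refl)        p<p = ⊥-elim (<-irrefl refl p<p)
  corner-side-up (inj₂ (inj₁ refl)) _   = side₁₂
  corner-side-up (inj₂ (inj₂ refl)) _   = side₁₃

  corner-side-down : ∀ {v p q r} → IsCorner v (p , q , r) → v < r → HasSide (p , q , r) (v , r)
  corner-side-down (inj₁ refl)        _   = side₁₃
  corner-side-down (inj₂ (inj₁ refl)) _   = side₂₃
  corner-side-down (inj₂ (inj₂ refl)) r<r = ⊥-elim (<-irrefl refl r<r)

  span : Tri n → ℕ
  span (x , _ , z) = toℕ z ∸ toℕ x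

  -- A side at b leaving the arc from a to c would cross (a , c).
  span-decreasing : (T : Triangulation n) {a b c : Vertex n} {t : Tri n} →
                    IsFace T (a , b , c) → IsFace T t → t ≢ (a , b , c) → IsCorner b t →
                    span t ℕ.< span (a , b , c)
  span-decreasing T {a} {b} {c} {p , q , r} F@(a<b , b<c , _) Ft@(p<q , q<r , _) t≢abc b∈t =
    shrink
    where
    a≤p : a ≤ p
    a≤p = ℕ.≮⇒≥ λ p<a → sides-noncrossing T (face-side T Ft (corner-side-up b∈t (<-trans p<a a<b)))
                           (face-side T F side₁₃) (inj₁ (p<a , a<b , b<c))
    r≤c : r ≤ c
    r≤c = ℕ.≮⇒≥ λ c<r → sides-noncrossing T (face-side T F side₁₃)
                           (face-side T Ft (corner-side-down b∈t (<-trans b<c c<r))) (inj₁ (a<b , b<c , c<r))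
    p≤r : p ≤ r
    p≤r = ℕ.<⇒≤ (<-trans p<q q<r)
    shrink : span (p , q , r) ℕ.< span (a , b , c)
    shrink with a ≟ p | r ≟ c
    ... | no a≢p | _ =
      ℕ.<-≤-trans (ℕ.∸-monoʳ-< (≤∧≢⇒< a≤p a≢p) p≤r) (ℕ.∸-monoˡ-≤ (toℕ a) r≤c)
    ... | yes _ | no r≢c =
      ℕ.≤-<-trans (ℕ.∸-monoʳ-≤ (toℕ r) a≤p) (ℕ.∸-monoˡ-< (≤∧≢⇒< r≤c r≢c) (ℕ.≤-trans a≤p p≤r))
    ... | yes refl | yes refl = ⊥-elim (t≢abc (middle b∈t))
      where
      middle : IsCorner b (a , q , c) → (a , q , c) ≡ (a , b , c)
      middle (inj₁ refl) = ⊥-elim (<-irrefl refl a<b)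
      middle (inj₂ (inj₁ refl)) = refl
      middle (inj₂ (inj₂ refl)) = ⊥-elim (<-irrefl refl b<c)

-- Signed degrees

δ : ∀ {k} → Fin k → Fin k → ℤ
δ v x = if does (v ≟ x) then 1ℤ else 0ℤ

δ-refl : ∀ {k} (v : Fin k) → δ v v ≡ 1ℤ
δ-refl v rewrite dec-true (v ≟ v) refl = refl

δ-≢ : ∀ {k} {v x : Fin k} → v ≢ x → δ v x ≡ 0ℤ
δ-≢ {v = v} {x} v≢x rewrite dec-false (v ≟ x) v≢x = refl

module _ {n : ℕ} where

  -- Counting corners with multiplicity makes cornerCount-quadrilateral a ring identity.
  cornerCount : Vertex n → Tri n → ℤ
  cornerCount v (x , y , z) = δ v x + δ v y + δ v z

  cornerCount-middle : ∀ {a b c} → a < b → b < c → cornerCount b (a , b , c) ≡ 1ℤ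
  cornerCount-middle {a} {b} {c} a<b b<c
    rewrite δ-≢ (<⇒≢ a<b ∘ sym) | δ-refl b | δ-≢ (<⇒≢ b<c) = refl

  cornerCount-off : ∀ {v} t → ¬ IsCorner v t → cornerCount v t ≡ 0ℤ
  cornerCount-off (x , y , z) v∉t
    rewrite δ-≢ (v∉t ∘ inj₁) | δ-≢ (v∉t ∘ inj₂ ∘ inj₁) | δ-≢ (v∉t ∘ inj₂ ∘ inj₂) = refl

  cornerCount-quadrilateral : ∀ v a b c e → + 3 ∣
    (cornerCount v (a , b , c) + cornerCount v (a , c , e)) + (cornerCount v (a , b , e) + cornerCount v (b , c , e))
  cornerCount-quadrilateral v a b c e =
    divides (δ v a + δ v b + δ v c + δ v e) (count (δ v a) (δ v b) (δ v c) (δ v e))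
    where
    count : ∀ x y z w → ((x + y + z) + (x + z + w)) + ((x + y + w) + (y + z + w)) ≡ (x + y + z + w) * + 3
    count = solve-∀

  isCorner? : (v : Vertex n) (t : Tri n) → Dec (IsCorner v t)
  isCorner? v (x , y , z) = v ≟ x ⊎-dec v ≟ y ⊎-dec v ≟ z

  isBoundary? : (s : Seg n) → Dec (IsBoundary n s)
  isBoundary? (i , j) =
    (ℕ.suc (toℕ i) ℕ.≟ toℕ j) ⊎-dec ((toℕ i ℕ.≟ 0) ×-dec (toℕ j ℕ.≟ ℕ.suc n))

  isSide? : (T : Triangulation n) (s : Seg n) → Dec (IsSide T s)
  isSide? T s = isBoundary? s ⊎-dec any? (≡-dec _≟_ _≟_ s) (diags T)

  isFace? : (T : Triangulation n) (t : Tri n) → Dec (IsFace T t)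
  isFace? T (x , y , z) =
    x <? y ×-dec y <? z ×-dec isSide? T (x , y) ×-dec isSide? T (y , z) ×-dec isSide? T (x , z)

  weight : SignedTriangulation n → Vertex n → Tri n → ℤ
  weight S v t = if does (isFace? (tri S) t) then cornerCount v t * σ (sgn S t) else 0ℤ

  signedDegree : SignedTriangulation n → Vertex n → ℤ
  signedDegree S v = ∑³ (weight S v)

  weight-face : ∀ S v {t} → IsFace (tri S) t → weight S v t ≡ cornerCount v t * σ (sgn S t)
  weight-face S v {t} F rewrite dec-true (isFace? (tri S) t) F = refl

  weight-nonface : ∀ S v {t} → ¬ IsFace (tri S) t → weight S v t ≡ 0ℤ
  weight-nonface S v {t} ¬F rewrite dec-false (isFace? (tri S) t) ¬F = refl

  weight-off-corner : ∀ S {v} t → ¬ IsCorner v t → weight S v t ≡ 0ℤ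
  weight-off-corner S {v} t v∉t with isFace? (tri S) t
  ... | yes F = begin
    weight S v t                      ≡⟨ weight-face S v F ⟩
    cornerCount v t * σ (sgn S t)     ≡⟨ cong (_* σ (sgn S t)) (cornerCount-off t v∉t) ⟩
    0ℤ * σ (sgn S t)                  ≡⟨ *-zeroˡ (σ (sgn S t)) ⟩
    0ℤ                                ∎
  ... | no ¬F = weight-nonface S v ¬F

  weight-cong : ∀ S S' v {t} →
                (IsFace (tri S) t → IsFace (tri S') t) → (IsFace (tri S') t → IsFace (tri S) t) →
                (IsFace (tri S) t → sgn S t ≡ sgn S' t) → weight S v t ≡ weight S' v t
  weight-cong S S' v {t} to from same-sign with isFace? (tri S) t
  ... | yes F = begin
    weight S v t                   ≡⟨ weight-face S v F ⟩
    cornerCount v t * σ (sgn S t)  ≡⟨ cong (λ s → cornerCount v t * σ s) (same-sign F) ⟩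
    cornerCount v t * σ (sgn S' t) ≡⟨ weight-face S' v (to F) ⟨
    weight S' v t                  ∎
  ... | no ¬F = trans (weight-nonface S v ¬F) (sym (weight-nonface S' v (¬F ∘ from)))

-- Signed flips

module _ {n : ℕ} where

  DiagonalExchange : Triangulation n → Triangulation n → Seg n → Seg n → Set
  DiagonalExchange T T' d d' = ∀ x → (x ∈ diags T') ⇔ (((x ∈ diags T) × (x ≢ d)) ⊎ (x ≡ d'))

  module Exchange {T T' : Triangulation n} {d d' : Seg n} (exchange : DiagonalExchange T T' d d') where

    side-kept : ∀ {s} → IsSide T s → s ≢ d → IsSide T' s
    side-kept (inj₁ s-boundary) _   = inj₁ s-boundary
    side-kept (inj₂ s∈T)        s≢d = inj₂ (Equivalence.from (exchange _) (inj₁ (s∈T , s≢d)))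

    side-restored : ∀ {s} → IsSide T' s → s ≢ d' → IsSide T s
    side-restored (inj₁ s-boundary) _ = inj₁ s-boundary
    side-restored (inj₂ s∈T') s≢d' with Equivalence.to (exchange _) s∈T'
    ... | inj₁ (s∈T , _) = inj₂ s∈T
    ... | inj₂ s≡d'      = ⊥-elim (s≢d' s≡d')

    new-side : IsSide T' d'
    new-side = inj₂ (Equivalence.from (exchange d') (inj₂ refl))

  module FlipChange {S S' : SignedTriangulation n} {d d' : Seg n} {f₁ f₂ f₁' f₂' : Tri n}
    (flip : FlipData S S' d d' f₁ f₂ f₁' f₂')
    (d×d' : Cross n d d')
    (f₁∋d : HasSide f₁ d) (f₂∋d : HasSide f₂ d) (f₁'∋d' : HasSide f₁' d') (f₂'∋d' : HasSide f₂' d')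
    (faces-on-d  : ∀ {t} → IsFace (tri S) t → HasSide t d → t ≡ f₁ ⊎ t ≡ f₂)
    (faces-on-d' : ∀ {t} → IsFace (tri S') t → HasSide t d' → t ≡ f₁' ⊎ t ≡ f₂')
    (f₁'-face : IsFace (tri S') f₁') (f₂'-face : IsFace (tri S') f₂')
    (f₁≢f₂ : f₁ ≢ f₂) (f₁'≢f₂' : f₁' ≢ f₂')
    where
    open FlipData flip
    open Exchange {tri S} {tri S'} {d} {d'} newDiags

    ¬face-after : ∀ {t} → HasSide t d → ¬ IsFace (tri S') t
    ¬face-after t∋d F = sides-noncrossing (tri S') (face-side (tri S') F t∋d) new-side d×d'

    ¬face-before : ∀ {t} → HasSide t d' → ¬ IsFace (tri S) t
    ¬face-before t∋d' F = sides-noncrossing (tri S) (inj₂ d∈T) (face-side (tri S) F t∋d') d×d'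

    face-kept : ∀ {t} → IsFace (tri S) t → t ≢ f₁ → t ≢ f₂ → IsFace (tri S') t
    face-kept F t≢f₁ t≢f₂ = face-from-sides (tri S) (tri S') F λ t∋s s-side →
      side-kept s-side λ { refl → [ t≢f₁ , t≢f₂ ]′ (faces-on-d F t∋s) }

    face-restored : ∀ {t} → IsFace (tri S') t → t ≢ f₁' → t ≢ f₂' → IsFace (tri S) t
    face-restored F t≢f₁' t≢f₂' = face-from-sides (tri S') (tri S) F λ t∋s s-side →
      side-restored s-side λ { refl → [ t≢f₁' , t≢f₂' ]′ (faces-on-d' F t∋s) }

    flipped-triangles : List (Tri n)
    flipped-triangles = f₁ ∷ f₂ ∷ f₁' ∷ f₂' ∷ []

    flipped-triangles-distinct : Unique flipped-triangles
    flipped-triangles-distinct =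
      (f₁≢f₂ ∷ face≢nonface face₁ (¬face-before f₁'∋d') ∷ face≢nonface face₁ (¬face-before f₂'∋d') ∷ []) ∷
      (face≢nonface face₂ (¬face-before f₁'∋d') ∷ face≢nonface face₂ (¬face-before f₂'∋d') ∷ []) ∷
      (f₁'≢f₂' ∷ []) ∷ [] ∷ []
      where
      face≢nonface : ∀ {t t'} → IsFace (tri S) t → ¬ IsFace (tri S) t' → t ≢ t'
      face≢nonface F ¬F' refl = ¬F' F

    weight-outside : ∀ v t → t ∉ flipped-triangles → weight S' v t ≡ weight S v t
    weight-outside v t t∉q = weight-cong S' S v
      (λ F → face-restored F (t∉q ∘ there ∘ there ∘ here) (t∉q ∘ there ∘ there ∘ there ∘ here))
      (λ F → face-kept F (t∉q ∘ here) (t∉q ∘ there ∘ here))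
      (λ F → keepSigns t F (t∉q ∘ there ∘ there ∘ here) (t∉q ∘ there ∘ there ∘ there ∘ here))

    module _ (v : Vertex n) where

      removed-face-change : ∀ {t} → IsFace (tri S) t → HasSide t d → sgn S t ≡ sgn S f₁ →
                            weight S' v t - weight S v t ≡ - (cornerCount v t * σ (sgn S f₁))
      removed-face-change {t} F t∋d t-sign = begin
        weight S' v t - weight S v t
          ≡⟨ cong₂ _-_ (weight-nonface S' v (¬face-after t∋d)) (weight-face S v F) ⟩
        0ℤ - cornerCount v t * σ (sgn S t)   ≡⟨ +-identityˡ _ ⟩
        - (cornerCount v t * σ (sgn S t))    ≡⟨ cong (λ s → - (cornerCount v t * σ s)) t-sign ⟩
        - (cornerCount v t * σ (sgn S f₁))   ∎

      created-face-change : ∀ {t} → IsFace (tri S') t → HasSide t d' → sgn S' t ≡ neg (sgn S f₁) →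
                            weight S' v t - weight S v t ≡ - (cornerCount v t * σ (sgn S f₁))
      created-face-change {t} F t∋d' t-sign = begin
        weight S' v t - weight S v t
          ≡⟨ cong₂ _-_ (weight-face S' v F) (weight-nonface S v (¬face-before t∋d')) ⟩
        cornerCount v t * σ (sgn S' t) - 0ℤ  ≡⟨ +-identityʳ _ ⟩
        cornerCount v t * σ (sgn S' t)       ≡⟨ cong (λ s → cornerCount v t * σ s) t-sign ⟩
        cornerCount v t * σ (neg (sgn S f₁)) ≡⟨ cong (cornerCount v t *_) (σ-neg (sgn S f₁)) ⟩
        cornerCount v t * - σ (sgn S f₁)     ≡⟨ neg-distribʳ-* (cornerCount v t) (σ (sgn S f₁)) ⟨
        - (cornerCount v t * σ (sgn S f₁))   ∎

      signedDegree-change : signedDegree S' v - signedDegree S v ≡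
        - ((cornerCount v f₁ + cornerCount v f₂) + (cornerCount v f₁' + cornerCount v f₂')) * σ (sgn S f₁)
      signedDegree-change = begin
        signedDegree S' v - signedDegree S v
          ≡⟨ ∑³-agree-outside flipped-triangles flipped-triangles-distinct (weight-outside v) ⟩
        (weight S' v f₁ - weight S v f₁) + ((weight S' v f₂ - weight S v f₂) +
          ((weight S' v f₁' - weight S v f₁') + ((weight S' v f₂' - weight S v f₂') + 0ℤ)))
          ≡⟨ cong₂ _+_ (removed-face-change face₁ f₁∋d refl)
              (cong₂ _+_ (removed-face-change face₂ f₂∋d (sym sameSign))
                (cong₂ _+_ (created-face-change f₁'-face f₁'∋d' newSign₁)
                  (cong₂ _+_ (created-face-change f₂'-face f₂'∋d' newSign₂) refl))) ⟩
        - (c₁ * x) + (- (c₂ * x) + (- (c₁' * x) + (- (c₂' * x) + 0ℤ)))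
          ≡⟨ collect c₁ c₂ c₁' c₂' x ⟩
        - ((c₁ + c₂) + (c₁' + c₂')) * x ∎
        where
        c₁ = cornerCount v f₁
        c₂ = cornerCount v f₂
        c₁' = cornerCount v f₁'
        c₂' = cornerCount v f₂'
        x = σ (sgn S f₁)
        collect : ∀ c₁ c₂ c₁' c₂' x →
          - (c₁ * x) + (- (c₂ * x) + (- (c₁' * x) + (- (c₂' * x) + 0ℤ))) ≡ - ((c₁ + c₂) + (c₁' + c₂')) * x
        collect = solve-∀

    signedDegree-invariant :
      (∀ v → + 3 ∣ (cornerCount v f₁ + cornerCount v f₂) + (cornerCount v f₁' + cornerCount v f₂')) →
      ∀ v → signedDegree S v ≡ signedDegree S' v mod + 3
    signedDegree-invariant 3∣cornerCounts v = congruent $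
      subst (+ 3 ∣_) (sym (signedDegree-change v))
        (∣m⇒∣m*n (σ (sgn S f₁)) (∣m⇒∣-m (3∣cornerCounts v)))

  signedDegree-flip : ∀ {S S'} → SignedFlip S S' → ∀ v → signedDegree S v ≡ signedDegree S' v mod + 3
  signedDegree-flip {S} {S'} (a , b , c , e , a<b , b<c , c<e , inj₁ flip) =
    signedDegree-invariant (λ v → cornerCount-quadrilateral v a b c e)
    where
    open FlipData flip
    open Exchange {tri S} {tri S'} {a , c} {b , e} newDiags
    abe-face : IsFace (tri S') (a , b , e)
    abe-face = a<b , <-trans b<c c<e ,
      side-kept (face-side (tri S) face₁ side₁₂) (<⇒≢ b<c ∘ ,-injectiveʳ) , new-side ,
      side-kept (face-side (tri S) face₂ side₁₃) (<⇒≢ c<e ∘ sym ∘ ,-injectiveʳ)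
    bce-face : IsFace (tri S') (b , c , e)
    bce-face = b<c , c<e ,
      side-kept (face-side (tri S) face₁ side₂₃) (<⇒≢ a<b ∘ sym ∘ ,-injectiveˡ) ,
      side-kept (face-side (tri S) face₂ side₂₃) (<⇒≢ (<-trans a<b b<c) ∘ sym ∘ ,-injectiveˡ) , new-side
    open FlipChange flip (inj₁ (a<b , b<c , c<e)) side₁₃ side₁₂ side₂₃ side₁₃
      (faces-on-side (tri S) face₁ face₂ (right c<e))
      (λ F t∋be → swap (faces-on-side (tri S') bce-face abe-face (left a<b) F t∋be))
      abe-face bce-face (<⇒≢ b<c ∘ ,-injectiveˡ ∘ ,-injectiveʳ) (<⇒≢ a<b ∘ ,-injectiveˡ)
  signedDegree-flip {S} {S'} (a , b , c , e , a<b , b<c , c<e , inj₂ flip) =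
    signedDegree-invariant λ v → subst (+ 3 ∣_)
      (+-comm (cornerCount v (a , b , c) + cornerCount v (a , c , e))
              (cornerCount v (a , b , e) + cornerCount v (b , c , e)))
      (cornerCount-quadrilateral v a b c e)
    where
    open FlipData flip
    open Exchange {tri S} {tri S'} {b , e} {a , c} newDiags
    abc-face : IsFace (tri S') (a , b , c)
    abc-face = a<b , b<c ,
      side-kept (face-side (tri S) face₁ side₁₂) (<⇒≢ a<b ∘ ,-injectiveˡ) ,
      side-kept (face-side (tri S) face₂ side₁₂) (<⇒≢ c<e ∘ ,-injectiveʳ) , new-side
    ace-face : IsFace (tri S') (a , c , e)
    ace-face = <-trans a<b b<c , c<e , new-side ,
      side-kept (face-side (tri S) face₂ side₂₃) (<⇒≢ b<c ∘ sym ∘ ,-injectiveˡ) ,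
      side-kept (face-side (tri S) face₁ side₁₃) (<⇒≢ a<b ∘ ,-injectiveˡ)
    open FlipChange flip (inj₂ (a<b , b<c , c<e)) side₂₃ side₁₃ side₁₃ side₁₂
      (λ F t∋be → swap (faces-on-side (tri S) face₂ face₁ (left a<b) F t∋be))
      (faces-on-side (tri S') abc-face ace-face (right c<e))
      abc-face ace-face (<⇒≢ a<b ∘ ,-injectiveˡ) (<⇒≢ b<c ∘ ,-injectiveˡ ∘ ,-injectiveʳ)

-- Signs from signed degrees

module _ {n : ℕ} where

  signedDegree-Σ : {S S' : SignedTriangulation n} → InSigma S S' →
                   ∀ v → signedDegree S v ≡ signedDegree S' v mod + 3
  signedDegree-Σ Star.ε         v = ≡-mod-refl _
  signedDegree-Σ (flip ◅ flips) v = ≡-mod-trans (signedDegree-flip flip v) (signedDegree-Σ flips v)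

  signedDegree-same-triangulation : {U U' : Triangulation n} (ε : Tri n → Sign) → SameTriangulation U U' →
                                    ∀ v → signedDegree (U ,ε ε) v ≡ signedDegree (U' ,ε ε) v
  signedDegree-same-triangulation {U} {U'} ε U≈U' v =
    ∑³-cong {g = weight (U ,ε ε) v} λ t → weight-cong (U ,ε ε) (U' ,ε ε) v
      (λ F → face-from-sides U U' F λ _ → side-to)
      (λ F → face-from-sides U' U F λ _ → side-from)
      (λ _ → refl)
    where
    side-to : ∀ {s} → IsSide U s → IsSide U' s
    side-to (inj₁ s-boundary) = inj₁ s-boundary
    side-to (inj₂ s∈U) = inj₂ (Equivalence.to (U≈U' _) s∈U)
    side-from : ∀ {s} → IsSide U' s → IsSide U s
    side-from (inj₁ s-boundary) = inj₁ s-boundary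
    side-from (inj₂ s∈U') = inj₂ (Equivalence.from (U≈U' _) s∈U')

  weight-middle : ∀ S {a b c : Vertex n} → IsFace (tri S) (a , b , c) →
                  weight S b (a , b , c) ≡ σ (sgn S (a , b , c))
  weight-middle S {a} {b} {c} F@(a<b , b<c , _) = begin
    weight S b t                  ≡⟨ weight-face S b F ⟩
    cornerCount b t * σ (sgn S t) ≡⟨ cong (_* σ (sgn S t)) (cornerCount-middle a<b b<c) ⟩
    1ℤ * σ (sgn S t)              ≡⟨ *-identityˡ _ ⟩
    σ (sgn S t)                   ∎
    where
    t = (a , b , c)

  module _ (U : Triangulation n) {ε₁ ε₂ : Tri n → Sign}
    (same-degrees : ∀ v → signedDegree (U ,ε ε₁) v ≡ signedDegree (U ,ε ε₂) v mod + 3) where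

    private
      S₁ = U ,ε ε₁
      S₂ = U ,ε ε₂

    signs-determined : ∀ t → IsFace U t → ε₁ t ≡ ε₂ t
    signs-determined t = go t (On.wellFounded span <-wellFounded t)
      where
      go : ∀ t → Acc (ℕ._<_ on span) t → IsFace U t → ε₁ t ≡ ε₂ t
      go t@(a , b , c) (acc smaller) F =
        σ-injective-mod-3 (≡-mod-difference degree-difference (same-degrees b))
        where
        agree-elsewhere : ∀ t' → t' ≢ t → weight S₂ b t' ≡ weight S₁ b t'
        agree-elsewhere t' t'≢t with isCorner? b t'
        ... | yes b∈t' = weight-cong S₂ S₁ b id id
                           (λ F' → sym (go t' (smaller (span-decreasing U F F' t'≢t b∈t')) F'))
        ... | no  b∉t' = trans (weight-off-corner S₂ t' b∉t') (sym (weight-off-corner S₁ t' b∉t'))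
        degree-difference : signedDegree S₂ b - signedDegree S₁ b ≡ σ (ε₂ t) - σ (ε₁ t)
        degree-difference = begin
          signedDegree S₂ b - signedDegree S₁ b ≡⟨ ∑³-agree-off t agree-elsewhere ⟩
          weight S₂ b t - weight S₁ b t         ≡⟨ cong₂ _-_ (weight-middle S₂ F) (weight-middle S₁ F) ⟩
          σ (ε₂ t) - σ (ε₁ t)                   ∎

mainTheorem9 : (n : ℕ) (T : Triangulation n) (ε : Tri n → Sign)
    (U U' : Triangulation n) (ε' ε'' : Tri n → Sign) →
    InSigma (T ,ε ε) (U ,ε ε') → InSigma (T ,ε ε) (U' ,ε ε'') →
    SameTriangulation U U' →
    ∀ f → IsFace U f → ε' f ≡ ε'' f
mainTheorem9 n T ε U U' ε' ε'' T↝U T↝U' U≈U' = signs-determined U same-degrees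
  where
  same-degrees : ∀ v → signedDegree (U ,ε ε') v ≡ signedDegree (U ,ε ε'') v mod + 3
  same-degrees v = subst (signedDegree (U ,ε ε') v ≡_mod + 3)
    (sym (signedDegree-same-triangulation {U = U} {U'} ε'' U≈U' v))
    (≡-mod-trans (≡-mod-sym (signedDegree-Σ T↝U v)) (signedDegree-Σ T↝U' v))
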